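{- Let $G=(V,E)$ be a claw-free graph with clique number $\omega(G)$. For any $v\in V$, \[ |N(N(v))\setminus\{v\}| \le \sum_{w\in N(v)\setminus Z(v)} |N(w)\setminus(\{v\}\cup N(v))| + \frac12\sum_{w\in Z(v)} |N(w)\setminus(\{v\}\cup N(v))| \le \Big(\deg(v)-\tfrac12|Z(v)|\Big)(\omega(G)-1). \]
   Context: A graph is claw-free if it has no induced $K_{1,3}$. $N(u)$ is the open neighbourhood of a vertex $u$; for a set $S$ of vertices, $N(S)=\bigcup_{s\in S}N(s)\setminus S$. For $v\in V$, $Z(v):=\{w\in N(v) : \exists\, x,y\in N(v)\text{ with } xw,wy\in E \text{ and } xy\notin E\}$. -}

module Defs where

open import Data.Nat using (ℕ; zero; suc; _+_; _*_; _∸_; _≤_)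
open import Data.Fin using (Fin)
open import Data.Bool using (Bool; true; false; if_then_else_; _∧_; _∨_; not)
open import Data.List using (List; map)
open import Data.Nat.ListAction using (sum)
open import Data.Bool.ListAction using (any)
open import Data.List.Base using (filter)
open import Data.Fin.Base using ()
open import Data.Product using (Σ; ∃; _×_; _,_)
open import Relation.Binary.PropositionalEquality using (_≡_; _≢_)
open import Relation.Nullary using (¬_; does)
open import Data.Fin.Properties using (_≟_)
open import Data.List using (allFin)

record Graph (n : ℕ) : Set where
  field
    adj   : Fin n → Fin n → Bool
    sym   : ∀ x y → adj x y ≡ adj y x
    irrefl : ∀ x → adj x x ≡ false
open Graph public

VSet : ℕ → Set
VSet n = Fin n → Bool

card : ∀ {n} → VSet n → ℕ
card {n} S = sum (map (λ x → if S x then 1 else 0) (allFin n))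

sumOver : ∀ {n} → VSet n → (Fin n → ℕ) → ℕ
sumOver {n} S f = sum (map (λ x → if S x then f x else 0) (allFin n))

existsV : ∀ {n} → (Fin n → Bool) → Bool
existsV {n} p = any p (allFin n)

module _ {n : ℕ} (G : Graph n) where

  N : Fin n → VSet n
  N u = adj G u

  NS : VSet n → VSet n
  NS S x = existsV (λ s → S s ∧ adj G s x) ∧ not (S x)

  ⟦_⟧ : Fin n → VSet n
  ⟦ v ⟧ x = does (x ≟ v)

  _∖_ : VSet n → VSet n → VSet n
  (A ∖ B) x = A x ∧ not (B x)

  _∪_ : VSet n → VSet n → VSet n
  (A ∪ B) x = A x ∨ B x

  deg : Fin n → ℕ
  deg v = card (N v)

  Z : Fin n → VSet n
  Z v w = N v w ∧ existsV (λ x → existsV (λ y →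
            N v x ∧ N v y ∧ adj G x w ∧ adj G w y ∧ not (adj G x y)
            ∧ not (does (x ≟ y))))

  ClawFree : Set
  ClawFree = ¬ (Σ (Fin n) λ c → Σ (Fin n) λ a → Σ (Fin n) λ b → Σ (Fin n) λ d →
               (a ≢ b) × (a ≢ d) × (b ≢ d) ×
               (adj G c a ≡ true) × (adj G c b ≡ true) × (adj G c d ≡ true) ×
               (adj G a b ≡ false) × (adj G a d ≡ false) × (adj G b d ≡ false))

  IsClique : VSet n → Set
  IsClique C = ∀ x y → C x ≡ true → C y ≡ true → x ≢ y → adj G x y ≡ true

  IsCliqueNumber : ℕ → Set
  IsCliqueNumber k = (Σ (VSet n) λ C → IsClique C × card C ≡ k)
                   × (∀ C → IsClique C → card C ≤ k)

-- Write B(w) = N(w) ∖ ({v} ∪ N(v)) and Q = N(N(v)) ∖ {v}.  Every x ∈ Q lies in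
-- B(w) for some w ∈ N(v).  If w ∉ Z(v) it is counted twice by the weight 2 of w;
-- if w ∈ Z(v), w has non-adjacent neighbours a, b ∈ N(v), and the claw at w with
-- leaves a, b, x forces a second vertex of N(v) adjacent to x, so x is still
-- counted twice by two weights 1.  Double counting gives the first inequality.
-- For w ∈ N(v), two non-adjacent vertices of B(w) would form a claw at w together
-- with v, so B(w) ∪ {w} is a clique and |B(w)| ≤ ω − 1, which gives the second.
module Submission where

open import Defs hiding (sym)
open import Data.Bool using (Bool; true; false; if_then_else_; _∧_; _∨_; not)
open import Data.Bool.Properties using (T-≡)
open import Data.Empty using (⊥-elim)
open import Data.Fin using (Fin; zero; suc)
open import Data.Fin.Properties using (_≟_)
open import Data.List using (map; allFin; tabulate)
open import Data.List.Properties using (map-tabulate)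
open import Data.List.Relation.Unary.Any using (satisfied)
open import Data.List.Relation.Unary.Any.Properties using (any⁻)
open import Data.Nat using (ℕ; zero; suc; _+_; _*_; _∸_; _≤_; z≤n)
open import Data.Nat.ListAction as List using ()
open import Data.Nat.Properties hiding (_≟_)
open import Algebra.Properties.Semiring.Sum +-*-semiring
  using (sum; sum-syntax; sum-cong-≗; ∑-distrib-+; ∑-comm; *-distribˡ-sum; *-distribʳ-sum)
open import Data.Product using (∃; _×_; _,_; proj₁; proj₂)
open import Data.Sum using (_⊎_; inj₁; inj₂)
open import Function using (_∘_; id)
open import Function.Bundles using (Equivalence)
open import Relation.Nullary using (does; yes; no)
open import Relation.Nullary.Decidable using (dec-true)
open import Relation.Binary.PropositionalEquality

χ : Bool → ℕ
χ b = if b then 1 else 0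

if-then-0≡χ* : ∀ b m → (if b then m else 0) ≡ χ b * m
if-then-0≡χ* true  m = sym (+-identityʳ m)
if-then-0≡χ* false m = refl

∑-mono-≤ : ∀ {m} {f g : Fin m → ℕ} → (∀ i → f i ≤ g i) → sum f ≤ sum g
∑-mono-≤ {zero}  f≤g = z≤n
∑-mono-≤ {suc m} f≤g = +-mono-≤ (f≤g zero) (∑-mono-≤ (f≤g ∘ suc))

term≤∑ : ∀ {m} (f : Fin m → ℕ) i → f i ≤ sum f
term≤∑ f zero    = m≤m+n _ _
term≤∑ f (suc i) = ≤-trans (term≤∑ (f ∘ suc) i) (m≤n+m _ _)

two-terms≤∑ : ∀ {m} (f : Fin m → ℕ) {i j} → i ≢ j → f i + f j ≤ sum f
two-terms≤∑ f {zero}  {zero}  i≢j = ⊥-elim (i≢j refl)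
two-terms≤∑ f {zero}  {suc j} i≢j = +-monoʳ-≤ (f zero) (term≤∑ (f ∘ suc) j)
two-terms≤∑ f {suc i} {zero}  i≢j =
  subst (_≤ sum f) (+-comm (f zero) (f (suc i))) (+-monoʳ-≤ (f zero) (term≤∑ (f ∘ suc) i))
two-terms≤∑ f {suc i} {suc j} i≢j =
  ≤-trans (two-terms≤∑ (f ∘ suc) (i≢j ∘ cong suc)) (m≤n+m _ _)

listSum-tabulate : ∀ {m} (f : Fin m → ℕ) → List.sum (tabulate f) ≡ sum f
listSum-tabulate {zero}  f = refl
listSum-tabulate {suc m} f = cong (f zero +_) (listSum-tabulate (f ∘ suc))

listSum-allFin : ∀ {m} (f : Fin m → ℕ) → List.sum (map f (allFin m)) ≡ sum f
listSum-allFin f = trans (cong List.sum (map-tabulate id f)) (listSum-tabulate f)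

card≡∑χ : ∀ {m} (S : VSet m) → card S ≡ ∑[ x < m ] χ (S x)
card≡∑χ S = listSum-allFin (χ ∘ S)

sumOver≡∑χ* : ∀ {m} (S : VSet m) (f : Fin m → ℕ) → sumOver S f ≡ ∑[ x < m ] (χ (S x) * f x)
sumOver≡∑χ* S f =
  trans (listSum-allFin (λ x → if S x then f x else 0)) (sum-cong-≗ (λ x → if-then-0≡χ* (S x) (f x)))

∧-true : ∀ {a b} → a ∧ b ≡ true → (a ≡ true) × (b ≡ true)
∧-true {true} {true} _ = refl , refl

not-true : ∀ {a} → not a ≡ true → a ≡ false
not-true {false} _ = refl

∨-true : ∀ {a b} → a ∨ b ≡ true → (a ≡ true) ⊎ (b ≡ true)
∨-true {true}  _ = inj₁ refl
∨-true {false} b = inj₂ b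

∨-false : ∀ {a b} → a ∨ b ≡ false → (a ≡ false) × (b ≡ false)
∨-false {false} {false} _ = refl , refl

≟-true⇒≡ : ∀ {m} {x y : Fin m} → does (x ≟ y) ≡ true → x ≡ y
≟-true⇒≡ {x = x} {y} e with x ≟ y
... | yes x≡y = x≡y

≟-false⇒≢ : ∀ {m} {x y : Fin m} → does (x ≟ y) ≡ false → x ≢ y
≟-false⇒≢ {x = x} {y} e with x ≟ y
... | no x≢y = x≢y

existsV-witness : ∀ {m} (p : Fin m → Bool) → existsV p ≡ true → ∃ λ x → p x ≡ true
existsV-witness {m} p e
  with x , px ← satisfied (any⁻ p (allFin m) (Equivalence.from T-≡ e))
  = x , Equivalence.to T-≡ px

-- The weight of w, for a = [w ∈ N(v)] and z = [w ∈ Z(v)]: summing weight · f over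
-- all w gives 2 Σ_{N(v)∖Z(v)} f + Σ_{Z(v)} f.
weight : (a z : Bool) → ℕ
weight a z = 2 * χ (a ∧ not z) + χ z

1≤weight-true : ∀ z → 1 ≤ weight true z
1≤weight-true true  = ≤-refl
1≤weight-true false = m≤n+m 1 1

weight*+χ*≤2*χ* : ∀ a z {m k} → (z ≡ true → a ≡ true) → (a ≡ true → m ≤ k) →
  weight a z * m + χ z * k ≤ 2 * χ a * k
weight*+χ*≤2*χ* true  true  {m} {k} _ m≤k = begin
  1 * m + 1 * k ≤⟨ +-monoˡ-≤ (1 * k) (*-monoʳ-≤ 1 (m≤k refl)) ⟩
  1 * k + 1 * k ≡⟨ *-distribʳ-+ k 1 1 ⟨
  2 * k         ∎
  where open ≤-Reasoning
weight*+χ*≤2*χ* true  false {m} {k} _ m≤k = begin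
  2 * m + 0 ≡⟨ +-identityʳ (2 * m) ⟩
  2 * m     ≤⟨ *-monoʳ-≤ 2 (m≤k refl) ⟩
  2 * k     ∎
  where open ≤-Reasoning
weight*+χ*≤2*χ* false true  z⇒a _ with () ← z⇒a refl
weight*+χ*≤2*χ* false false _   _ = z≤n

card-insert : ∀ {m} (S : VSet m) w → S w ≡ false →
  card S + 1 ≤ card (λ x → S x ∨ does (x ≟ w))
card-insert {m} S w Sw≡false = begin
  card S + 1
    ≤⟨ +-mono-≤ (≤-reflexive (card≡∑χ S))
                (subst (λ b → χ b ≤ ∑[ x < m ] χ (does (x ≟ w))) (dec-true (w ≟ w) refl) (term≤∑ _ w)) ⟩
  ∑[ x < m ] χ (S x) + ∑[ x < m ] χ (does (x ≟ w))
    ≡⟨ ∑-distrib-+ (χ ∘ S) (λ x → χ (does (x ≟ w))) ⟨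
  ∑[ x < m ] (χ (S x) + χ (does (x ≟ w)))
    ≤⟨ ∑-mono-≤ χ+χ≤χ∨ ⟩
  ∑[ x < m ] χ (S x ∨ does (x ≟ w))
    ≡⟨ card≡∑χ (λ x → S x ∨ does (x ≟ w)) ⟨
  card (λ x → S x ∨ does (x ≟ w)) ∎
  where
  open ≤-Reasoning
  χ+χ≤χ∨ : ∀ x → χ (S x) + χ (does (x ≟ w)) ≤ χ (S x ∨ does (x ≟ w))
  χ+χ≤χ∨ x with x ≟ w
  ... | yes refl rewrite Sw≡false = ≤-refl
  ... | no _ with S x
  ...   | true  = ≤-refl
  ...   | false = ≤-refl

module _ {n} (G : Graph n) where

  adj⇒≢ : ∀ {x y} → adj G x y ≡ true → x ≢ y
  adj⇒≢ {x} xy refl with () ← trans (sym xy) (irrefl G x)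

  adj-distinguishes : ∀ {v x y} → adj G v x ≡ true → adj G v y ≡ false → x ≢ y
  adj-distinguishes vx vy refl with () ← trans (sym vx) vy

  clawFree⇒adj : ClawFree G → ∀ {c a b d} →
    adj G c a ≡ true → adj G c b ≡ true → adj G c d ≡ true →
    a ≢ b → a ≢ d → b ≢ d → adj G a b ≡ false → adj G a d ≡ false → adj G b d ≡ true
  clawFree⇒adj clawFree {c} {a} {b} {d} ca cb cd a≢b a≢d b≢d ab ad with adj G b d in bd
  ... | true  = refl
  ... | false = ⊥-elim (clawFree (c , a , b , d , a≢b , a≢d , b≢d , ca , cb , cd , ab , ad , bd))

module Neighbourhood {n} (G : Graph n) (clawFree : ClawFree G) (v : Fin n) where

  B : Fin n → VSet n
  B w = _∖_ G (N G w) (_∪_ G (⟦_⟧ G v) (N G v))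

  Q : VSet n
  Q = _∖_ G (NS G (N G v)) (⟦_⟧ G v)

  NZ : VSet n
  NZ = _∖_ G (N G v) (Z G v)

  B-intro : ∀ {w x} → adj G w x ≡ true → does (x ≟ v) ≡ false → adj G v x ≡ false → B w x ≡ true
  B-intro wx x≢v vx rewrite wx | x≢v | vx = refl

  B-elim : ∀ {w x} → B w x ≡ true → (adj G w x ≡ true) × (does (x ≟ v) ≡ false) × (adj G v x ≡ false)
  B-elim {w} {x} Bwx
    with wx , outside ← ∧-true {adj G w x} Bwx
    with x≢v , vx ← ∨-false {does (x ≟ v)} (not-true outside)
    = wx , x≢v , vx

  Q-elim : ∀ {x} → Q x ≡ true →
    (does (x ≟ v) ≡ false) × (adj G v x ≡ false) × ∃ λ w → (adj G v w ≡ true) × (adj G w x ≡ true)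
  Q-elim {x} Qx
    with nbhd , x≢v ← ∧-true Qx
    with reached , vx ← ∧-true nbhd
    with w , vwx ← existsV-witness _ reached
    = not-true x≢v , not-true vx , w , ∧-true vwx

  Z⇒N : ∀ w → Z G v w ≡ true → adj G v w ≡ true
  Z⇒N w = proj₁ ∘ ∧-true

  B∪⟦w⟧-clique : ∀ w → adj G v w ≡ true → IsClique G (λ x → B w x ∨ does (x ≟ w))
  B∪⟦w⟧-clique w vw x y Cx Cy x≢y with ∨-true {B w x} Cx | ∨-true {B w y} Cy
  ... | inj₁ Bwx | inj₁ Bwy
    with wx , x≢v , vx ← B-elim Bwx
    with wy , y≢v , vy ← B-elim Bwy
    = clawFree⇒adj G clawFree (trans (Graph.sym G w v) vw) wx wy
        (≟-false⇒≢ x≢v ∘ sym) (≟-false⇒≢ y≢v ∘ sym) x≢y vx vy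
  ... | inj₁ Bwx | inj₂ y≡w =
    subst (λ z → adj G x z ≡ true) (sym (≟-true⇒≡ y≡w)) (trans (Graph.sym G x w) (proj₁ (B-elim Bwx)))
  ... | inj₂ x≡w | inj₁ Bwy =
    subst (λ z → adj G z y ≡ true) (sym (≟-true⇒≡ x≡w)) (proj₁ (B-elim Bwy))
  ... | inj₂ x≡w | inj₂ y≡w = ⊥-elim (x≢y (trans (≟-true⇒≡ x≡w) (sym (≟-true⇒≡ y≡w))))

  |B|≤ω∸1 : ∀ {ω} → IsCliqueNumber G ω → ∀ w → adj G v w ≡ true → card (B w) ≤ ω ∸ 1
  |B|≤ω∸1 {ω} (_ , maximal) w vw = m+n≤o⇒m≤o∸n (card (B w)) (begin
    card (B w) + 1                      ≤⟨ card-insert (B w) w Bww≡false ⟩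
    card (λ x → B w x ∨ does (x ≟ w))   ≤⟨ maximal _ (B∪⟦w⟧-clique w vw) ⟩
    ω                                   ∎)
    where
    open ≤-Reasoning
    Bww≡false : B w w ≡ false
    Bww≡false rewrite irrefl G w = refl

  Z-second-neighbour : ∀ {w x} → Z G v w ≡ true → B w x ≡ true →
    ∃ λ c → (adj G v c ≡ true) × (B c x ≡ true) × (c ≢ w)
  Z-second-neighbour {w} {x} Zw Bwx
    with a , ∃b ← existsV-witness _ (proj₂ (∧-true Zw))
    with b , abw ← existsV-witness _ ∃b
    with va , abw ← ∧-true abw
    with vb , abw ← ∧-true abw
    with aw , abw ← ∧-true abw
    with wb , abw ← ∧-true abw
    with ab , a≢b ← ∧-true abw
    with wx , x≢v , vx ← B-elim Bwx
    with adj G a x in ax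
  ... | true  = a , va , B-intro ax x≢v vx , adj⇒≢ G aw
  ... | false = b , vb , B-intro bx x≢v vx , adj⇒≢ G wb ∘ sym
    where
    bx : adj G b x ≡ true
    bx = clawFree⇒adj G clawFree (trans (Graph.sym G w a) aw) wb wx
           (≟-false⇒≢ (not-true a≢b)) (adj-distinguishes G va vx) (adj-distinguishes G vb vx)
           (not-true ab) ax

  weightOf : Fin n → ℕ
  weightOf w = weight (adj G v w) (Z G v w)

  discountedSum≡∑weightOf* : ∀ f →
    2 * sumOver NZ f + sumOver (Z G v) f ≡ ∑[ w < n ] (weightOf w * f w)
  discountedSum≡∑weightOf* f = begin
    2 * sumOver NZ f + sumOver (Z G v) f
      ≡⟨ cong₂ (λ s t → 2 * s + t) (sumOver≡∑χ* NZ f) (sumOver≡∑χ* (Z G v) f) ⟩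
    2 * ∑[ w < n ] (χ (NZ w) * f w) + ∑[ w < n ] (χ (Z G v w) * f w)
      ≡⟨ cong (_+ ∑[ w < n ] (χ (Z G v w) * f w)) (*-distribˡ-sum 2 (λ w → χ (NZ w) * f w)) ⟩
    ∑[ w < n ] (2 * (χ (NZ w) * f w)) + ∑[ w < n ] (χ (Z G v w) * f w)
      ≡⟨ ∑-distrib-+ (λ w → 2 * (χ (NZ w) * f w)) (λ w → χ (Z G v w) * f w) ⟨
    ∑[ w < n ] (2 * (χ (NZ w) * f w) + χ (Z G v w) * f w)
      ≡⟨ sum-cong-≗ (λ w → distrib (χ (NZ w)) (χ (Z G v w)) (f w)) ⟨
    ∑[ w < n ] (weightOf w * f w) ∎
    where
    open ≡-Reasoning
    distrib : ∀ a b c → (2 * a + b) * c ≡ 2 * (a * c) + b * c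
    distrib a b c = trans (*-distribʳ-+ c (2 * a) b) (cong (_+ b * c) (*-assoc 2 a c))

  weightOf*χB : ∀ {w x} → adj G v w ≡ true → B w x ≡ true →
    weightOf w * χ (B w x) ≡ weight true (Z G v w)
  weightOf*χB {w} vw Bwx rewrite vw | Bwx = *-identityʳ _

  column-bound : ∀ x → 2 * χ (Q x) ≤ ∑[ w < n ] (weightOf w * χ (B w x))
  column-bound x with Q x in Qx
  ... | false = z≤n
  ... | true
    with x≢v , vx , w , vw , wx ← Q-elim Qx
    with Bwx ← B-intro wx x≢v vx
    with Z G v w in Zw
  ... | false = ≤-trans (≤-reflexive (trans (cong (weight true) (sym Zw)) (sym (weightOf*χB vw Bwx))))
                        (term≤∑ _ w)
  ... | true
    with c , vc , Bcx , c≢w ← Z-second-neighbour Zw Bwx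
    = ≤-trans (+-mono-≤ (1≤term vw Bwx) (1≤term vc Bcx)) (two-terms≤∑ _ (c≢w ∘ sym))
    where
    1≤term : ∀ {u} → adj G v u ≡ true → B u x ≡ true → 1 ≤ weightOf u * χ (B u x)
    1≤term {u} vu Bux = subst (1 ≤_) (sym (weightOf*χB vu Bux)) (1≤weight-true (Z G v u))

  2*|Q|≤discountedSum : 2 * card Q ≤ 2 * sumOver NZ (card ∘ B) + sumOver (Z G v) (card ∘ B)
  2*|Q|≤discountedSum = begin
    2 * card Q
      ≡⟨ cong (2 *_) (card≡∑χ Q) ⟩
    2 * ∑[ x < n ] χ (Q x)
      ≡⟨ *-distribˡ-sum 2 (χ ∘ Q) ⟩
    ∑[ x < n ] (2 * χ (Q x))
      ≤⟨ ∑-mono-≤ column-bound ⟩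
    ∑[ x < n ] ∑[ w < n ] (weightOf w * χ (B w x))
      ≡⟨ ∑-comm (λ w x → weightOf w * χ (B w x)) ⟨
    ∑[ w < n ] ∑[ x < n ] (weightOf w * χ (B w x))
      ≡⟨ sum-cong-≗ (λ w → *-distribˡ-sum (weightOf w) (χ ∘ B w)) ⟨
    ∑[ w < n ] (weightOf w * ∑[ x < n ] χ (B w x))
      ≡⟨ sum-cong-≗ (λ w → cong (weightOf w *_) (card≡∑χ (B w))) ⟨
    ∑[ w < n ] (weightOf w * card (B w))
      ≡⟨ discountedSum≡∑weightOf* (card ∘ B) ⟨
    2 * sumOver NZ (card ∘ B) + sumOver (Z G v) (card ∘ B) ∎
    where open ≤-Reasoning

  discountedSum≤ : ∀ {ω} → IsCliqueNumber G ω →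
    2 * sumOver NZ (card ∘ B) + sumOver (Z G v) (card ∘ B) ≤ (2 * deg G v ∸ card (Z G v)) * (ω ∸ 1)
  discountedSum≤ {ω} isω =
    subst (2 * sumOver NZ (card ∘ B) + sumOver (Z G v) (card ∘ B) ≤_)
          (sym (*-distribʳ-∸ k (2 * deg G v) (card (Z G v))))
          (m+n≤o⇒m≤o∸n _ (begin
    2 * sumOver NZ (card ∘ B) + sumOver (Z G v) (card ∘ B) + card (Z G v) * k
      ≡⟨ cong₂ _+_ (discountedSum≡∑weightOf* (card ∘ B))
                   (trans (cong (_* k) (card≡∑χ (Z G v))) (*-distribʳ-sum k (χ ∘ Z G v))) ⟩
    ∑[ w < n ] (weightOf w * card (B w)) + ∑[ w < n ] (χ (Z G v w) * k)
      ≡⟨ ∑-distrib-+ (λ w → weightOf w * card (B w)) (λ w → χ (Z G v w) * k) ⟨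
    ∑[ w < n ] (weightOf w * card (B w) + χ (Z G v w) * k)
      ≤⟨ ∑-mono-≤ (λ w → weight*+χ*≤2*χ* (adj G v w) (Z G v w) (Z⇒N w) (|B|≤ω∸1 isω w)) ⟩
    ∑[ w < n ] (2 * χ (adj G v w) * k)
      ≡⟨ *-distribʳ-sum k (λ w → 2 * χ (adj G v w)) ⟨
    ∑[ w < n ] (2 * χ (adj G v w)) * k
      ≡⟨ cong (_* k) (*-distribˡ-sum 2 (χ ∘ adj G v)) ⟨
    2 * ∑[ w < n ] χ (adj G v w) * k
      ≡⟨ cong (λ d → 2 * d * k) (card≡∑χ (N G v)) ⟨
    2 * deg G v * k ∎))
    where
    open ≤-Reasoning
    k : ℕ
    k = ω ∸ 1

lemma5p1 : ∀ {n : ℕ} (G : Graph n) → ClawFree G → (ω : ℕ) → IsCliqueNumber G ω → (v : Fin n) →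
    let A : Fin n → ℕ
        A w = card (_∖_ G (N G w) (_∪_ G (⟦_⟧ G v) (N G v)))
    in (2 * card (_∖_ G (NS G (N G v)) (⟦_⟧ G v))
          ≤ 2 * sumOver (_∖_ G (N G v) (Z G v)) A + sumOver (Z G v) A)
     × (2 * sumOver (_∖_ G (N G v) (Z G v)) A + sumOver (Z G v) A
          ≤ (2 * deg G v ∸ card (Z G v)) * (ω ∸ 1))
lemma5p1 G clawFree ω isω v = 2*|Q|≤discountedSum , discountedSum≤ isω
  where open Neighbourhood G clawFree v
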